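{- Let $\mathcal V$ be a unital commutative quantale and $F\colon\mathsf{Set}\to\mathsf{Set}$ a functor preserving weak pullbacks. Then the canonical lifting $\hat F_{can}$ satisfies: (1) $\hat F_{can}(p\otimes q)\ge\hat F_{can}(p)\otimes\hat F_{can}(q)$ for all $p,q\colon X\to\mathcal V$; (2) $\hat F_{can}(1_X)\ge 1_{FX}$ for every set $X$.
   Context: A unital commutative quantale $\mathcal V$ is a complete lattice $(\mathcal V,\le)$ with an associative, commutative operation $\otimes$ distributing over arbitrary joins $\bigvee$, with unit $1$. For $r\in\mathcal V$ let ${\uparrow}r=\{v\in\mathcal V\mid v\ge r\}$ with inclusion $\iota_r\colon{\uparrow}r\to\mathcal V$; for $u\in F\mathcal V$ write $u\in F({\uparrow}r)$ if $u$ is in the image of $F\iota_r$. The canonical evaluation map is $ev_{can}(u)=\bigvee\{r\mid u\in F({\uparrow}r)\}$ and the canonical lifting of $F$ to $\mathcal V$-valued predicates sends $p\colon X\to\mathcal V$ to $\hat F_{can}(p)=ev_{can}\circ F(p)\colon FX\to\mathcal V$, i.e. $\hat F_{can}(p)(u)=\bigvee\{r\mid F(p)(u)\in F({\uparrow}r)\}$. Notation: $1_X\colon X\to\mathcal V$ is the constant map $x\mapsto1$, and $(p\otimes q)(x)=p(x)\otimes q(x)$; inequalities between predicates are pointwise. -}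

module Defs where

open import Level using (0ℓ)
open import Data.Product using (Σ; ∃; _×_; _,_; proj₁; proj₂)
open import Function using (_∘_; id)
open import Relation.Binary.PropositionalEquality using (_≡_)
open import Relation.Binary.Structures using (IsPartialOrder)

record Quantale : Set₁ where
  field
    Carrier   : Set
    _≤_       : Carrier → Carrier → Set
    isPartialOrder : IsPartialOrder _≡_ _≤_
    ⋁         : (Carrier → Set) → Carrier
    ⋁-upper   : (S : Carrier → Set) (v : Carrier) → S v → v ≤ ⋁ S
    ⋁-least   : (S : Carrier → Set) (u : Carrier) →
                ((v : Carrier) → S v → v ≤ u) → ⋁ S ≤ u
    _⊗_       : Carrier → Carrier → Carrier
    𝟙         : Carrier
    ⊗-assoc   : ∀ a b c → (a ⊗ b) ⊗ c ≡ a ⊗ (b ⊗ c)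
    ⊗-comm    : ∀ a b → a ⊗ b ≡ b ⊗ a
    ⊗-unit    : ∀ a → 𝟙 ⊗ a ≡ a
    -- a ⊗ ⋁ S = ⋁ { a ⊗ s | s ∈ S }  (right distributivity follows by commutativity)
    ⊗-distrib-⋁ : ∀ a (S : Carrier → Set) →
                  a ⊗ ⋁ S ≡ ⋁ (λ v → Σ Carrier (λ s → S s × (v ≡ a ⊗ s)))

record Functor : Set₁ where
  field
    F₀     : Set → Set
    fmap   : {A B : Set} → (A → B) → F₀ A → F₀ B
    fmap-id : {A : Set} (u : F₀ A) → fmap id u ≡ u
    fmap-∘  : {A B C : Set} (f : A → B) (g : B → C) (u : F₀ A) →
              fmap (g ∘ f) u ≡ fmap g (fmap f u)

-- A commuting square  p₁ : W → A, p₂ : W → B  over  f : A → C, g : B → C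
-- is a weak pullback in Set iff every compatible pair (a , b) has a
-- (not necessarily unique) mediating element of W.
IsWeakPullback : {W A B C : Set} (f : A → C) (g : B → C)
                 (p₁ : W → A) (p₂ : W → B) → Set
IsWeakPullback {W} {A} {B} f g p₁ p₂ =
  (a : A) (b : B) → f a ≡ g b → Σ W (λ w → (p₁ w ≡ a) × (p₂ w ≡ b))

PreservesWeakPullbacks : Functor → Set₁
PreservesWeakPullbacks Fn =
  {W A B C : Set} (f : A → C) (g : B → C) (p₁ : W → A) (p₂ : W → B) →
  ((w : W) → f (p₁ w) ≡ g (p₂ w)) →
  IsWeakPullback f g p₁ p₂ →
  IsWeakPullback (fmap f) (fmap g) (fmap p₁) (fmap p₂)
  where open Functor Fn

module _ (Q : Quantale) (Fn : Functor) where
  open Quantale Q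
  open Functor Fn

  ↑ : Carrier → Set
  ↑ r = Σ Carrier (λ v → r ≤ v)

  ι : (r : Carrier) → ↑ r → Carrier
  ι r = proj₁

  _∈F↑_ : F₀ Carrier → Carrier → Set
  u ∈F↑ r = Σ (F₀ (↑ r)) (λ w → fmap (ι r) w ≡ u)

  ev-can : F₀ Carrier → Carrier
  ev-can u = ⋁ (λ r → u ∈F↑ r)

  F̂-can : {X : Set} → (X → Carrier) → F₀ X → Carrier
  F̂-can p = ev-can ∘ fmap p

  _⊗ᵖ_ : {X : Set} → (X → Carrier) → (X → Carrier) → X → Carrier
  (p ⊗ᵖ q) x = p x ⊗ q x

  1ᵖ : (X : Set) → X → Carrier
  1ᵖ X x = 𝟙

-- On the functor side, write u ∈F P when u lies in the image of
-- F(Σ X P) → F X. Then fmap p u ∈F↑ r says u ∈F { x | r ≤ p x }, and preservation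
-- of weak pullbacks lets F commute with preimages and binary intersections. So
-- if fmap p u ∈F↑ r and fmap q u ∈F↑ s, then u ∈F { x | r ≤ p x , s ≤ q x }
-- ⊆ { x | r ⊗ s ≤ p x ⊗ q x }, i.e. fmap (p ⊗ᵖ q) u ∈F↑ (r ⊗ s), which gives (1).
-- For (2), F(Σ X (λ _ → 𝟙 ≤ 𝟙)) → F X is split by x ↦ (x , refl).
module Submission where

open import Defs
open import Data.Product using (_×_; Σ; _,_; proj₁; proj₂)
open import Data.Sum using (_⊎_; inj₁; inj₂)
open import Function using (_∘_)
open import Relation.Binary.PropositionalEquality
  using (_≡_; refl; sym; trans; cong; subst; subst₂; module ≡-Reasoning)
open import Relation.Binary.Structures using (IsPartialOrder)

module QuantaleProperties (Q : Quantale) where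
  open Quantale Q
  open IsPartialOrder isPartialOrder
    using (antisym) renaming (refl to ≤-refl; trans to ≤-trans)

  ⊗-⋁-least : ∀ a (S : Carrier → Set) b → (∀ s → S s → (a ⊗ s) ≤ b) → (a ⊗ ⋁ S) ≤ b
  ⊗-⋁-least a S b h = subst (_≤ b) (sym (⊗-distrib-⋁ a S))
    (⋁-least _ b (λ { _ (s , s∈S , refl) → h s s∈S }))

  -- When a ≤ b, b is the join of {a , b}; distributing c ⊗_ over it gives c ⊗ a ≤ c ⊗ b.
  ⊗-monoʳ-≤ : ∀ c {a b} → a ≤ b → (c ⊗ a) ≤ (c ⊗ b)
  ⊗-monoʳ-≤ c {a} {b} a≤b = subst ((c ⊗ a) ≤_) (sym c⊗b≡⋁) c⊗a≤⋁
    where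
    pair : Carrier → Set
    pair x = (x ≡ a) ⊎ (x ≡ b)

    ⋁pair≡b : ⋁ pair ≡ b
    ⋁pair≡b = antisym (⋁-least pair b (λ { _ (inj₁ refl) → a≤b ; _ (inj₂ refl) → ≤-refl }))
                      (⋁-upper pair b (inj₂ refl))

    c⊗b≡⋁ : c ⊗ b ≡ ⋁ (λ v → Σ Carrier (λ s → pair s × (v ≡ c ⊗ s)))
    c⊗b≡⋁ = trans (cong (c ⊗_) (sym ⋁pair≡b)) (⊗-distrib-⋁ c pair)

    c⊗a≤⋁ : (c ⊗ a) ≤ ⋁ (λ v → Σ Carrier (λ s → pair s × (v ≡ c ⊗ s)))
    c⊗a≤⋁ = ⋁-upper _ (c ⊗ a) (a , inj₁ refl , refl)

  ⊗-monoˡ-≤ : ∀ c {a b} → a ≤ b → (a ⊗ c) ≤ (b ⊗ c)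
  ⊗-monoˡ-≤ c {a} {b} a≤b = subst₂ _≤_ (⊗-comm c a) (⊗-comm c b) (⊗-monoʳ-≤ c a≤b)

  ⊗-mono-≤ : ∀ {a b c d} → a ≤ b → c ≤ d → (a ⊗ c) ≤ (b ⊗ d)
  ⊗-mono-≤ {b = b} {c = c} a≤b c≤d = ≤-trans (⊗-monoˡ-≤ c a≤b) (⊗-monoʳ-≤ b c≤d)

  ⋁-⊗-⋁-least : ∀ (S T : Carrier → Set) b →
                (∀ r s → S r → T s → (r ⊗ s) ≤ b) → (⋁ S ⊗ ⋁ T) ≤ b
  ⋁-⊗-⋁-least S T b h = ⊗-⋁-least (⋁ S) T b λ s s∈T →
    subst (_≤ b) (⊗-comm s (⋁ S)) (⊗-⋁-least s S b λ r r∈S →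
      subst (_≤ b) (⊗-comm r s) (h r s r∈S s∈T))

module FunctorSubsets (Fn : Functor) where
  open Functor Fn

  _∈F_ : {X : Set} → F₀ X → (X → Set) → Set
  u ∈F P = Σ (F₀ (Σ _ P)) (λ z → fmap proj₁ z ≡ u)

  ∈F-universal : {X : Set} {P : X → Set} → (∀ x → P x) → (u : F₀ X) → u ∈F P
  ∈F-universal all u = fmap (λ x → x , all x) u , trans (sym (fmap-∘ _ proj₁ u)) (fmap-id u)

  ∈F-map : {X Y : Set} {P : X → Set} {R : Y → Set} (f : X → Y) →
           (∀ x → P x → R (f x)) → {u : F₀ X} → u ∈F P → fmap f u ∈F R
  ∈F-map f f-maps {u} (z , z↦u) = fmap (λ (x , px) → f x , f-maps x px) z , fz↦fu
    where
    open ≡-Reasoning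
    fz↦fu : fmap proj₁ (fmap (λ (x , px) → f x , f-maps x px) z) ≡ fmap f u
    fz↦fu = begin
      fmap proj₁ (fmap _ z) ≡⟨ sym (fmap-∘ _ proj₁ z) ⟩
      fmap (f ∘ proj₁) z    ≡⟨ fmap-∘ proj₁ f z ⟩
      fmap f (fmap proj₁ z) ≡⟨ cong (fmap f) z↦u ⟩
      fmap f u              ∎

  module _ (pwp : PreservesWeakPullbacks Fn) where

    ∈F-preimage : {X Y : Set} {R : Y → Set} (f : X → Y) {u : F₀ X} →
                  fmap f u ∈F R → u ∈F (R ∘ f)
    ∈F-preimage f {u} (z , z↦fu) =
      let (w , w↦u , _) = pwp f proj₁ proj₁ (λ (x , rfx) → f x , rfx) (λ _ → refl)
                            (λ { x (_ , ry) refl → (x , ry) , refl , refl }) u z (sym z↦fu)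
      in w , w↦u

    ∈F-∩ : {X : Set} {P R : X → Set} {u : F₀ X} →
           u ∈F P → u ∈F R → u ∈F (λ x → P x × R x)
    ∈F-∩ {P = P} {R} {u} (z₁ , z₁↦u) (z₂ , z₂↦u) =
      let (w , w↦z₁ , _) = pwp {Σ _ (λ x → P x × R x)} proj₁ proj₁
                             (λ (x , px , _) → x , px) (λ (x , _ , rx) → x , rx) (λ _ → refl)
                             (λ { (x , px) (_ , rx) refl → (x , px , rx) , refl , refl })
                             z₁ z₂ (trans z₁↦u (sym z₂↦u))
      in w , trans (fmap-∘ _ proj₁ w) (trans (cong (fmap proj₁) w↦z₁) z₁↦u)

module _ (Q : Quantale) (Fn : Functor) where
  open Quantale Q
  open Functor Fn
  open QuantaleProperties Q
  open FunctorSubsets Fn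
  open IsPartialOrder isPartialOrder using () renaming (refl to ≤-refl)

  ∈F↑-⊗ : PreservesWeakPullbacks Fn → {X : Set} (p q : X → Carrier) {u : F₀ X} {r s : Carrier} →
          _∈F↑_ Q Fn (fmap p u) r → _∈F↑_ Q Fn (fmap q u) s →
          _∈F↑_ Q Fn (fmap (_⊗ᵖ_ Q Fn p q) u) (r ⊗ s)
  ∈F↑-⊗ pwp p q pu∈↑r qu∈↑s =
    ∈F-map (_⊗ᵖ_ Q Fn p q) (λ _ (r≤px , s≤qx) → ⊗-mono-≤ r≤px s≤qx)
      (∈F-∩ pwp (∈F-preimage pwp p pu∈↑r) (∈F-preimage pwp q qu∈↑s))

  𝟙≤F̂-can-1ᵖ : (X : Set) (u : F₀ X) → 𝟙 ≤ F̂-can Q Fn (1ᵖ Q Fn X) u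
  𝟙≤F̂-can-1ᵖ X u = ⋁-upper _ 𝟙 (∈F-map (1ᵖ Q Fn X) (λ _ 𝟙≤𝟙 → 𝟙≤𝟙) (∈F-universal (λ _ → ≤-refl) u))

proposition22 : (Q : Quantale) (Fn : Functor) → PreservesWeakPullbacks Fn →
    ((X : Set) (p q : X → Quantale.Carrier Q) (u : Functor.F₀ Fn X) →
      Quantale._≤_ Q (Quantale._⊗_ Q (F̂-can Q Fn p u) (F̂-can Q Fn q u))
                     (F̂-can Q Fn (_⊗ᵖ_ Q Fn p q) u))
    × ((X : Set) (u : Functor.F₀ Fn X) →
      Quantale._≤_ Q (Quantale.𝟙 Q) (F̂-can Q Fn (1ᵖ Q Fn X) u))
proposition22 Q Fn pwp = lax-⊗ , 𝟙≤F̂-can-1ᵖ Q Fn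
  where
  open Quantale Q
  open Functor Fn
  open QuantaleProperties Q

  lax-⊗ : (X : Set) (p q : X → Carrier) (u : F₀ X) →
          (F̂-can Q Fn p u ⊗ F̂-can Q Fn q u) ≤ F̂-can Q Fn (_⊗ᵖ_ Q Fn p q) u
  lax-⊗ X p q u = ⋁-⊗-⋁-least _ _ _ λ r s pu∈↑r qu∈↑s →
    ⋁-upper _ (r ⊗ s) (∈F↑-⊗ Q Fn pwp p q pu∈↑r qu∈↑s)
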